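{- Let $T$ be a finite tree, $\omega$ a nonnegative integer function on $V(T)$, and $D$ a distribution on $T$ which is not $\omega$-solvable and satisfies $|D|=\gamma_\omega(T)-1$. Then for each vertex $x\in V(T)$ that is not a leaf of $T$, there exists $y\in N(x)$ with $C_x(y)\ge 0$.
   Context: A distribution assigns nonnegative integers (pebbles) to vertices, $|D|$ is the total. A pebbling move removes two pebbles from a vertex and adds one to an adjacent vertex; $D$ is $\omega$-solvable if pebbling moves reach $D^*\ge\omega$ pointwise; $\gamma_\omega(T)$ is the least $m$ such that every distribution with $m$ pebbles is $\omega$-solvable. Let $C=D-\omega$. For a leaf $v$ of a tree with neighbor $u$, the induced function on the tree minus $v$ is $C'$ with $C'(z)=C(z)$ for $z\ne u$, $C'(u)=C(u)+\lfloor C(v)/2\rfloor$ if $C(v)\ge0$ and $C'(u)=C(u)+2C(v)$ if $C(v)<0$. For a subtree $T^*$, the induced generalized distribution on $T^*$ is obtained by repeatedly deleting leaves not in $T^*$ with this rule. $T_x$ is the subtree consisting of $x$ and all its neighbors $N(x)$, and $C_x$ is the induced generalized distribution on $T_x$. -}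

module Defs where

open import Data.Nat as ℕ using (ℕ; zero; suc; _≤_; _∸_; _/_)
open import Data.Integer as ℤ using (ℤ; +_; -[1+_])
open import Data.Fin using (Fin; toℕ; _≟_)
open import Data.Fin using (suc) renaming (zero to fzero)
open import Data.Vec using (tabulate; sum)
open import Data.Bool using (Bool; true; false; if_then_else_)
open import Data.Product using (Σ; ∃; ∃-syntax; _×_; _,_)
open import Data.Sum using (_⊎_)
open import Relation.Nullary using (¬_)
open import Relation.Nullary.Decidable using (⌊_⌋)
open import Relation.Binary.PropositionalEquality using (_≡_)
open import Relation.Binary.Construct.Closure.ReflexiveTransitive using (Star)

-- Finite (nonempty) trees, encoded by a parent function:
-- vertices are Fin (suc n); vertex (suc i) is joined to (parent i),
-- which has a strictly smaller index.  Every finite nonempty tree is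
-- isomorphic to such a tree.

record Tree : Set where
  field
    n       : ℕ
    parent  : Fin n → Fin (suc n)
    parent< : ∀ i → toℕ (parent i) ≤ toℕ i

V : Tree → Set
V T = Fin (suc (Tree.n T))

Adj : (T : Tree) → V T → V T → Set
Adj T u v = (∃[ i ] (u ≡ suc i × v ≡ Tree.parent T i))
          ⊎ (∃[ i ] (v ≡ suc i × u ≡ Tree.parent T i))

IsLeaf : (T : Tree) → V T → Set
IsLeaf T v = ∃[ u ] (Adj T v u × (∀ w → Adj T v w → w ≡ u))

Dist : Tree → Set
Dist T = V T → ℕ

size : (T : Tree) → Dist T → ℕ
size T D = sum (tabulate D)

applyMove : (T : Tree) → V T → V T → Dist T → Dist T
applyMove T u v D w =
  if ⌊ w ≟ u ⌋ then D w ∸ 2 else (if ⌊ w ≟ v ⌋ then suc (D w) else D w)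

data Move (T : Tree) (D : Dist T) : Dist T → Set where
  move : ∀ u v → Adj T u v → 2 ≤ D u → Move T D (applyMove T u v D)

Solvable : (T : Tree) → (ω : V T → ℕ) → Dist T → Set
Solvable T ω D = ∃[ D* ] (Star (Move T) D D* × (∀ w → ω w ≤ D* w))

IsPebblingNumber : (T : Tree) → (ω : V T → ℕ) → ℕ → Set
IsPebblingNumber T ω m =
  (∀ D → size T D ≡ m → Solvable T ω D)
  × (∀ m′ → m′ ℕ.< m → ¬ (∀ D → size T D ≡ m′ → Solvable T ω D))

excess : (T : Tree) → Dist T → (V T → ℕ) → V T → ℤ
excess T D ω v = + D v ℤ.- + ω v

-- amount passed to the neighbour when deleting a leaf with value c
push : ℤ → ℤ
push (+ k)      = + (k / 2)
push -[1+ k ]   = + 2 ℤ.* -[1+ k ]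

InTx : (T : Tree) → V T → V T → Set
InTx T x w = w ≡ x ⊎ Adj T x w

removeV : (T : Tree) → V T → (V T → Bool) → V T → Bool
removeV T v S w = if ⌊ w ≟ v ⌋ then false else S w

addAt : (T : Tree) → V T → ℤ → (V T → ℤ) → V T → ℤ
addAt T u a C w = if ⌊ w ≟ u ⌋ then C w ℤ.+ a else C w

-- one leaf deletion: the current subtree is S (as a vertex set) with
-- generalized distribution C; v is a leaf of the current subtree not in
-- T_x, with unique neighbour u in the current subtree.
data Delete (T : Tree) (x : V T) :
       (V T → Bool) × (V T → ℤ) → (V T → Bool) × (V T → ℤ) → Set where
  delete : ∀ S C v u →
    S v ≡ true → ¬ InTx T x v →
    Adj T v u → S u ≡ true →
    (∀ w → Adj T v w → S w ≡ true → w ≡ u) →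
    Delete T x (S , C) (removeV T v S , addAt T u (push (C v)) C)

-- Cx is (the values on T_x of) the induced generalized distribution on T_x
-- of C, obtained by repeatedly deleting leaves not in T_x.
Induced : (T : Tree) → V T → (V T → ℤ) → (V T → ℤ) → Set
Induced T x C Cx =
  ∃[ S ] (Star (Delete T x) ((λ _ → true) , C) (S , Cx)
          × (∀ w → (S w ≡ true → InTx T x w) × (InTx T x w → S w ≡ true)))

module Submission where

-- Let C = D - ω and Cx its induced distribution on the star T_x.  Deleting
-- the neighbours of x too leaves x alone with value
--   centreValue x Cx = Cx x + Σ_{y ∈ N(x)} push (Cx y).
-- The key fact is a criterion: D is ω-solvable iff a reduction of D - ω to
-- x alone ends nonnegative.  Sufficiency is proved backwards along the
-- deletions (a surplus is shipped to the neighbour first, a deficit is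
-- covered by it afterwards); necessity by showing that a pebbling move can
-- only lower the final value (the relation Below, replayed along deletions).
-- For lemma4, suppose all neighbours of the non-leaf x are negative and take
-- two of them, y₁ with the larger value.  Moving all pebbles of x plus one
-- new pebble onto y₁ gives γ pebbles, hence a solvable distribution, whose
-- induced distribution changes only at x and y₁; comparing the two centre
-- values is contradictory (boost-arith).

open import Defs
open import Data.Nat using (ℕ; _+_; _≤_)
open import Data.Integer using (ℤ; +_) renaming (_≤_ to _≤ℤ_)
open import Data.Product using (∃-syntax; _×_)
open import Relation.Nullary using (¬_)
open import Relation.Binary.PropositionalEquality using (_≡_)

import Data.Nat as ℕ
import Data.Nat.Properties as ℕP
import Data.Nat.DivMod as ℕD
import Data.Nat.Tactic.RingSolver as ℕSolver
import Data.Integer as ℤ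
import Data.Integer.Properties as ℤP
open import Data.Integer using (-[1+_]; _<_)
open import Data.Integer.Tactic.RingSolver using (solve-∀)
open import Data.Bool using (Bool; true; false; if_then_else_)
open import Data.Empty using (⊥; ⊥-elim)
open import Data.Fin as F using (Fin; toℕ) renaming (zero to fz; suc to fs)
import Data.Fin.Properties as FP
open import Data.Vec using (tabulate; sum)
import Data.Vec.Properties as VP
open import Data.List using (List; []; _∷_; allFin)
open import Data.List.Membership.Propositional using (_∈_)
import Data.List.Membership.Propositional.Properties as Membership
open import Data.List.Relation.Unary.Any using (here; there)
import Data.List.Relation.Unary.All as All
open import Data.List.Relation.Unary.Unique.Propositional using (Unique; []; _∷_)
import Data.List.Relation.Unary.Unique.Propositional.Properties as Unique
open import Data.Product using (_,_; proj₁; proj₂)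
open import Data.Sum using (_⊎_; inj₁; inj₂)
open import Relation.Nullary using (Dec; yes; no)
open import Relation.Nullary.Decidable using (⌊_⌋; _⊎-dec_; _×-dec_; _→-dec_)
open import Relation.Binary.Definitions using (tri<; tri≈; tri>)
open import Relation.Binary.Construct.Closure.ReflexiveTransitive using (Star; ε; _◅_; _◅◅_)
open import Relation.Binary.PropositionalEquality
  using (refl; sym; trans; cong; cong₂; subst; subst₂; _≢_; module ≡-Reasoning)

push-neg : ∀ k → push -[1+ k ] ≡ -[1+ k ] ℤ.+ -[1+ k ]
push-neg k = double -[1+ k ]
  where
  double : ∀ (i : ℤ) → + 2 ℤ.* i ≡ i ℤ.+ i
  double = solve-∀

push-mono : ∀ {c d} → c ≤ℤ d → push c ≤ℤ push d
push-mono (ℤ.+≤+ m≤n) = ℤ.+≤+ (ℕD./-monoˡ-≤ 2 m≤n)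
push-mono { -[1+ m ]} ℤ.-≤+ = ℤP.≤-trans (ℤP.≤-reflexive (push-neg m)) ℤ.-≤+
push-mono { -[1+ m ]} { -[1+ n ]} (ℤ.-≤- n≤m) = begin
  push -[1+ m ]            ≡⟨ push-neg m ⟩
  -[1+ m ] ℤ.+ -[1+ m ]    ≤⟨ ℤP.+-mono-≤ (ℤ.-≤- n≤m) (ℤ.-≤- n≤m) ⟩
  -[1+ n ] ℤ.+ -[1+ n ]    ≡⟨ sym (push-neg n) ⟩
  push -[1+ n ]            ∎
  where open ℤP.≤-Reasoning

half-of-2+ : ∀ k → (k ℕ.+ 2) ℕ./ 2 ≡ ℕ.suc (k ℕ./ 2)
half-of-2+ k = trans (ℕD.m/n≡1+[m∸n]/n {k ℕ.+ 2} {2} (ℕP.m≤n+m 2 k))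
                     (cong (λ z → ℕ.suc (z ℕ./ 2)) (ℕP.m+n∸n≡m k 2))

push-+2 : ∀ c → push c ℤ.+ + 1 ≤ℤ push (c ℤ.+ + 2)
push-+2 (+ k) = ℤ.+≤+ (ℕP.≤-reflexive (trans (ℕP.+-comm (k ℕ./ 2) 1) (sym (half-of-2+ k))))
push-+2 -[1+ 0 ] = ℤ.-≤+
push-+2 -[1+ 1 ] = ℤ.-≤+
push-+2 -[1+ ℕ.suc (ℕ.suc k) ] = begin
  push c ℤ.+ + 1                       ≡⟨ cong (ℤ._+ + 1) (push-neg (ℕ.suc (ℕ.suc k))) ⟩
  (c ℤ.+ c) ℤ.+ + 1                    ≡⟨ shift c ⟩
  (-[1+ k ] ℤ.+ -[1+ k ]) ℤ.- + 3      ≤⟨ ℤP.i-j≤i (-[1+ k ] ℤ.+ -[1+ k ]) (+ 3) ⟩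
  -[1+ k ] ℤ.+ -[1+ k ]                ≡⟨ sym (push-neg k) ⟩
  push -[1+ k ]                        ∎
  where
  open ℤP.≤-Reasoning
  c = -[1+ ℕ.suc (ℕ.suc k) ]
  shift : ∀ c → (c ℤ.+ c) ℤ.+ + 1 ≡ ((c ℤ.+ + 2) ℤ.+ (c ℤ.+ + 2)) ℤ.- + 3
  shift = solve-∀

push-+1 : ∀ c → push (c ℤ.+ + 1) ≤ℤ push c ℤ.+ + 2
push-+1 (+ k) = ℤ.+≤+ (begin
  (k ℕ.+ 1) ℕ./ 2   ≤⟨ ℕD./-monoˡ-≤ 2 (ℕP.+-monoʳ-≤ k (ℕP.n≤1+n 1)) ⟩
  (k ℕ.+ 2) ℕ./ 2   ≡⟨ half-of-2+ k ⟩
  ℕ.suc (k ℕ./ 2)   ≤⟨ ℕP.n≤1+n _ ⟩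
  2 ℕ.+ k ℕ./ 2     ≡⟨ ℕP.+-comm 2 (k ℕ./ 2) ⟩
  k ℕ./ 2 ℕ.+ 2     ∎)
  where open ℕP.≤-Reasoning
push-+1 -[1+ 0 ] = ℤP.≤-refl
push-+1 -[1+ ℕ.suc k ] = ℤP.≤-reflexive (begin
  push -[1+ k ]                                    ≡⟨ push-neg k ⟩
  -[1+ k ] ℤ.+ -[1+ k ]                            ≡⟨ shift -[1+ ℕ.suc k ] ⟩
  (-[1+ ℕ.suc k ] ℤ.+ -[1+ ℕ.suc k ]) ℤ.+ + 2      ≡⟨ cong (ℤ._+ + 2) (sym (push-neg (ℕ.suc k))) ⟩
  push -[1+ ℕ.suc k ] ℤ.+ + 2                      ∎)
  where
  open ≡-Reasoning
  shift : ∀ c → (c ℤ.+ + 1) ℤ.+ (c ℤ.+ + 1) ≡ (c ℤ.+ c) ℤ.+ + 2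
  shift = solve-∀

push-half : ∀ c → push c ℤ.+ push c ≤ℤ c
push-half (+ k) = ℤ.+≤+ (subst (ℕ._≤ k) (twice (k ℕ./ 2)) (ℕD.m/n*n≤m k 2))
  where
  twice : ∀ m → m ℕ.* 2 ≡ m ℕ.+ m
  twice m = trans (ℕP.*-comm m 2) (cong (m ℕ.+_) (ℕP.+-identityʳ m))
push-half -[1+ k ] = begin
  push c ℤ.+ push c              ≡⟨ cong₂ ℤ._+_ (push-neg k) (push-neg k) ⟩
  (c ℤ.+ c) ℤ.+ (c ℤ.+ c)        ≡⟨ regroup c ⟩
  c ℤ.+ ((c ℤ.+ c) ℤ.+ c)        ≤⟨ ℤP.+-monoʳ-≤ c (ℤ.-≤+ {n = 0}) ⟩
  c ℤ.+ + 0                      ≡⟨ ℤP.+-identityʳ c ⟩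
  c                              ∎
  where
  open ℤP.≤-Reasoning
  c = -[1+ k ]
  regroup : ∀ c → (c ℤ.+ c) ℤ.+ (c ℤ.+ c) ≡ c ℤ.+ ((c ℤ.+ c) ℤ.+ c)
  regroup = solve-∀

push-nonneg : ∀ {c} → + 0 ≤ℤ c → + 0 ≤ℤ push c
push-nonneg (ℤ.+≤+ _) = ℤ.+≤+ ℕ.z≤n

push-nonpos : ∀ {c} → c < + 0 → push c ≤ℤ + 0
push-nonpos { -[1+ k ]} _ = subst (_≤ℤ + 0) (sym (push-neg k)) ℤ.-≤+
push-nonpos { + k } (ℤ.+<+ ())

push-deficit : ∀ k → push -[1+ k ] ℤ.+ + (ℕ.suc k ℕ.* 2) ≡ + 0
push-deficit k = begin
  push -[1+ k ] ℤ.+ + (ℕ.suc k ℕ.* 2)             ≡⟨ cong₂ ℤ._+_ (push-neg k) (ℤP.pos-* (ℕ.suc k) 2) ⟩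
  (ℤ.- M ℤ.+ ℤ.- M) ℤ.+ M ℤ.* + 2                  ≡⟨ cancel M ⟩
  + 0                                              ∎
  where
  open ≡-Reasoning
  M = + ℕ.suc k
  cancel : ∀ M → (ℤ.- M ℤ.+ ℤ.- M) ℤ.+ M ℤ.* + 2 ≡ + 0
  cancel = solve-∀

slack-move : ∀ {a b e : ℤ} → a ≤ℤ b ℤ.+ e → a ℤ.- e ≤ℤ b
slack-move {a} {b} {e} a≤b+e = begin
  a ℤ.- e               ≤⟨ ℤP.+-monoˡ-≤ (ℤ.- e) a≤b+e ⟩
  (b ℤ.+ e) ℤ.- e       ≡⟨ cancel b e ⟩
  b                     ∎
  where
  open ℤP.≤-Reasoning
  cancel : ∀ b e → (b ℤ.+ e) ℤ.- e ≡ b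
  cancel = solve-∀

trade-slack : ∀ {a b c d e : ℤ} → a ≤ℤ b ℤ.+ e → c ℤ.+ e ≤ℤ d → a ℤ.+ c ≤ℤ b ℤ.+ d
trade-slack {a} {b} {c} {d} {e} a≤b+e c+e≤d = begin
  a ℤ.+ c                       ≡⟨ regroup a c e ⟩
  (a ℤ.- e) ℤ.+ (c ℤ.+ e)       ≤⟨ ℤP.+-mono-≤ (slack-move {a} {b} {e} a≤b+e) c+e≤d ⟩
  b ℤ.+ d                       ∎
  where
  open ℤP.≤-Reasoning
  regroup : ∀ a c e → a ℤ.+ c ≡ (a ℤ.- e) ℤ.+ (c ℤ.+ e)
  regroup = solve-∀

-- With c = C_x(x), A = D(x), p = C_x(y₁), Σ and
-- Σ⁺ the sums of pushes from the neighbours of x before and after moving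
-- the A pebbles of x (and one more) onto y₁, the hypotheses are
-- incompatible: doubling  0 ≤ c - A + Σ⁺  and substituting the others
-- forces A - c ≤ p < 0 ≤ A - c.
boost-arith : ∀ {c A p Σ Σ⁺ : ℤ} → c ℤ.+ Σ < + 0 → + 0 ≤ℤ (c ℤ.- A) ℤ.+ Σ⁺ →
              Σ⁺ ℤ.+ push p ≡ Σ ℤ.+ push (p ℤ.+ (A ℤ.+ + 1)) → Σ ≤ℤ push p ℤ.+ push p →
              p < + 0 → c ≤ℤ A → ⊥
boost-arith {c} {A} {p} {Σ} {Σ⁺} c+Σ<0 0≤c-A+Σ⁺ Σ⁺-change Σ≤2q p<0 c≤A =
  ℤP.<-irrefl refl (ℤP.suc[i]≤j⇒i<j (subst (_≤ℤ R) (balance c A p Σ P q) total))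
  where
  q = push p
  P = push (p ℤ.+ (A ℤ.+ + 1))
  Σ⁺≡ : Σ⁺ ≡ (Σ ℤ.+ P) ℤ.- q
  Σ⁺≡ = trans (sym (unshift Σ⁺ q)) (cong (ℤ._- q) Σ⁺-change)
    where
    unshift : ∀ a b → (a ℤ.+ b) ℤ.- b ≡ a
    unshift = solve-∀
  after : + 0 ≤ℤ (c ℤ.- A) ℤ.+ ((Σ ℤ.+ P) ℤ.- q)
  after = subst (λ s → + 0 ≤ℤ (c ℤ.- A) ℤ.+ s) Σ⁺≡ 0≤c-A+Σ⁺
  R : ℤ
  R = (((((+ 0 ℤ.+ ((c ℤ.- A) ℤ.+ ((Σ ℤ.+ P) ℤ.- q))) ℤ.+ ((c ℤ.- A) ℤ.+ ((Σ ℤ.+ P) ℤ.- q)))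
        ℤ.+ (p ℤ.+ (A ℤ.+ + 1))) ℤ.+ (q ℤ.+ q)) ℤ.+ + 0) ℤ.+ A
  total : (((((ℤ.suc (c ℤ.+ Σ) ℤ.+ + 0) ℤ.+ + 0) ℤ.+ (P ℤ.+ P)) ℤ.+ Σ) ℤ.+ ℤ.suc p) ℤ.+ c ≤ℤ R
  total = ℤP.+-mono-≤ (ℤP.+-mono-≤ (ℤP.+-mono-≤ (ℤP.+-mono-≤ (ℤP.+-mono-≤ (ℤP.+-mono-≤
            (ℤP.i<j⇒suc[i]≤j c+Σ<0) after) after) (push-half (p ℤ.+ (A ℤ.+ + 1)))) Σ≤2q)
            (ℤP.i<j⇒suc[i]≤j p<0)) c≤A
  balance : ∀ c A p Σ P q →
            ((((((+ 1 ℤ.+ (c ℤ.+ Σ)) ℤ.+ + 0) ℤ.+ + 0) ℤ.+ (P ℤ.+ P)) ℤ.+ Σ) ℤ.+ (+ 1 ℤ.+ p)) ℤ.+ c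
            ≡ + 1 ℤ.+ ((((((+ 0 ℤ.+ ((c ℤ.- A) ℤ.+ ((Σ ℤ.+ P) ℤ.- q))) ℤ.+ ((c ℤ.- A) ℤ.+ ((Σ ℤ.+ P) ℤ.- q)))
                       ℤ.+ (p ℤ.+ (A ℤ.+ + 1))) ℤ.+ (q ℤ.+ q)) ℤ.+ + 0) ℤ.+ A)
  balance = solve-∀

sum-change-at : ∀ {m} (f g : Fin m → ℕ) p → (∀ w → w ≢ p → f w ≡ g w) →
                sum (tabulate f) ℕ.+ g p ≡ sum (tabulate g) ℕ.+ f p
sum-change-at {ℕ.suc m} f g fz agree =
  trans (cong (λ S → (f fz ℕ.+ S) ℕ.+ g fz) tails) (swap (f fz) (g fz) _)
  where
  tails : sum (tabulate (λ w → f (fs w))) ≡ sum (tabulate (λ w → g (fs w)))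
  tails = cong sum (VP.tabulate-cong (λ w → agree (fs w) (λ ())))
  swap : ∀ a b S → (a ℕ.+ S) ℕ.+ b ≡ (b ℕ.+ S) ℕ.+ a
  swap = ℕSolver.solve-∀
sum-change-at {ℕ.suc m} f g (fs p) agree = begin
  (f fz ℕ.+ Sf) ℕ.+ g (fs p)   ≡⟨ ℕP.+-assoc (f fz) Sf _ ⟩
  f fz ℕ.+ (Sf ℕ.+ g (fs p))   ≡⟨ cong₂ ℕ._+_ (agree fz (λ ())) tails ⟩
  g fz ℕ.+ (Sg ℕ.+ f (fs p))   ≡⟨ sym (ℕP.+-assoc (g fz) Sg _) ⟩
  (g fz ℕ.+ Sg) ℕ.+ f (fs p)   ∎
  where
  open ≡-Reasoning
  Sf = sum (tabulate (λ w → f (fs w)))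
  Sg = sum (tabulate (λ w → g (fs w)))
  tails : Sf ℕ.+ g (fs p) ≡ Sg ℕ.+ f (fs p)
  tails = sum-change-at (λ w → f (fs w)) (λ w → g (fs w)) p
            (λ w w≢p → agree (fs w) (λ e → w≢p (FP.suc-injective e)))

∑ : ∀ {A : Set} → List A → (A → ℤ) → ℤ
∑ [] f = + 0
∑ (a ∷ as) f = f a ℤ.+ ∑ as f

∑-cong : ∀ {A : Set} {f g : A → ℤ} as → (∀ {a} → a ∈ as → f a ≡ g a) → ∑ as f ≡ ∑ as g
∑-cong [] _ = refl
∑-cong (a ∷ as) agree = cong₂ ℤ._+_ (agree (here refl)) (∑-cong as (λ a∈as → agree (there a∈as)))

∑-change-at : ∀ {A : Set} {y : A} (f g : A → ℤ) as → Unique as → y ∈ as →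
              (∀ a → a ≢ y → f a ≡ g a) → ∑ as f ℤ.+ g y ≡ ∑ as g ℤ.+ f y
∑-change-at f g (a ∷ as) (a∉as ∷ _) (here refl) agree =
  trans (cong (λ S → (f a ℤ.+ S) ℤ.+ g a) (∑-cong as (λ b∈as → agree _ (b≢a b∈as)))) (swap (f a) (g a) _)
  where
  b≢a : ∀ {b} → b ∈ as → b ≢ a
  b≢a b∈as b≡a = All.lookup a∉as b∈as (sym b≡a)
  swap : ∀ p q S → (p ℤ.+ S) ℤ.+ q ≡ (q ℤ.+ S) ℤ.+ p
  swap = solve-∀
∑-change-at {y = y} f g (a ∷ as) (a∉as ∷ unique) (there y∈as) agree = begin
  (f a ℤ.+ ∑ as f) ℤ.+ g y   ≡⟨ ℤP.+-assoc (f a) _ (g y) ⟩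
  f a ℤ.+ (∑ as f ℤ.+ g y)   ≡⟨ cong₂ ℤ._+_ (agree a a≢y) (∑-change-at f g as unique y∈as agree) ⟩
  g a ℤ.+ (∑ as g ℤ.+ f y)   ≡⟨ sym (ℤP.+-assoc (g a) _ (f y)) ⟩
  (g a ℤ.+ ∑ as g) ℤ.+ f y   ∎
  where
  open ≡-Reasoning
  a≢y : a ≢ y
  a≢y = All.lookup a∉as y∈as

∑-≤-one : ∀ {A : Set} {y : A} {f : A → ℤ} as → y ∈ as → (∀ a → f a ≤ℤ + 0) → ∑ as f ≤ℤ f y
∑-≤-one {f = f} (a ∷ as) (here refl) nonpos = begin
  f a ℤ.+ ∑ as f   ≤⟨ ℤP.+-monoʳ-≤ (f a) (∑-≤-zero as) ⟩
  f a ℤ.+ + 0      ≡⟨ ℤP.+-identityʳ (f a) ⟩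
  f a              ∎
  where
  open ℤP.≤-Reasoning
  ∑-≤-zero : ∀ as → ∑ as f ≤ℤ + 0
  ∑-≤-zero [] = ℤP.≤-refl
  ∑-≤-zero (b ∷ bs) = ℤP.+-mono-≤ (nonpos b) (∑-≤-zero bs)
∑-≤-one {f = f} (a ∷ as) (there y∈as) nonpos =
  subst (f a ℤ.+ ∑ as f ≤ℤ_) (ℤP.+-identityˡ _) (ℤP.+-mono-≤ (nonpos a) (∑-≤-one as y∈as nonpos))

∑-≤-two : ∀ {A : Set} {y₁ y₂ : A} {f : A → ℤ} as → y₁ ∈ as → y₂ ∈ as → y₁ ≢ y₂ →
          (∀ a → f a ≤ℤ + 0) → ∑ as f ≤ℤ f y₁ ℤ.+ f y₂
∑-≤-two (a ∷ as) (here refl) (here refl) y₁≢y₂ nonpos = ⊥-elim (y₁≢y₂ refl)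
∑-≤-two {f = f} (a ∷ as) (here refl) (there y₂∈as) _ nonpos =
  ℤP.+-monoʳ-≤ (f a) (∑-≤-one as y₂∈as nonpos)
∑-≤-two {y₁ = y₁} {f = f} (a ∷ as) (there y₁∈as) (here refl) _ nonpos =
  subst (f a ℤ.+ ∑ as f ≤ℤ_) (ℤP.+-comm (f a) (f y₁)) (ℤP.+-monoʳ-≤ (f a) (∑-≤-one as y₁∈as nonpos))
∑-≤-two {f = f} (a ∷ as) (there y₁∈as) (there y₂∈as) y₁≢y₂ nonpos =
  subst (f a ℤ.+ ∑ as f ≤ℤ_) (ℤP.+-identityˡ _)
    (ℤP.+-mono-≤ (nonpos a) (∑-≤-two as y₁∈as y₂∈as y₁≢y₂ nonpos))

if-≡ : ∀ {m} {A : Set} {w u : Fin m} {a b : A} → w ≡ u → (if ⌊ w F.≟ u ⌋ then a else b) ≡ a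
if-≡ {w = w} {u} w≡u with w F.≟ u
... | yes _ = refl
... | no w≢u = ⊥-elim (w≢u w≡u)

if-≢ : ∀ {m} {A : Set} {w u : Fin m} {a b : A} → w ≢ u → (if ⌊ w F.≟ u ⌋ then a else b) ≡ b
if-≢ {w = w} {u} w≢u with w F.≟ u
... | yes w≡u = ⊥-elim (w≢u w≡u)
... | no _ = refl

live-not-dead : ∀ {b : Bool} → b ≡ true → b ≡ false → ⊥
live-not-dead live dead with trans (sym live) dead
... | ()

largest-of-three : (p q r : ℕ) → p ≢ q → q ≢ r → p ≢ r →
                   (q ℕ.< p × r ℕ.< p) ⊎ (p ℕ.< q × r ℕ.< q) ⊎ (p ℕ.< r × q ℕ.< r)
largest-of-three p q r p≢q q≢r p≢r with ℕP.<-cmp p q | ℕP.<-cmp q r | ℕP.<-cmp p r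
... | tri≈ _ p≡q _ | _ | _ = ⊥-elim (p≢q p≡q)
... | _ | tri≈ _ q≡r _ | _ = ⊥-elim (q≢r q≡r)
... | _ | _ | tri≈ _ p≡r _ = ⊥-elim (p≢r p≡r)
... | tri< p<q _ _ | tri< q<r _ _ | _ = inj₂ (inj₂ (ℕP.<-trans p<q q<r , q<r))
... | tri< p<q _ _ | tri> _ _ r<q | _ = inj₂ (inj₁ (p<q , r<q))
... | tri> _ _ q<p | tri< q<r _ _ | tri< p<r _ _ = inj₂ (inj₂ (p<r , q<r))
... | tri> _ _ q<p | tri< _ _ _ | tri> _ _ r<p = inj₁ (q<p , r<p)
... | tri> _ _ q<p | tri> _ _ r<q | _ = inj₁ (q<p , ℕP.<-trans r<q q<p)

module _ (T : Tree) where
  open Tree T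

  adj-sym : ∀ {u v} → Adj T u v → Adj T v u
  adj-sym (inj₁ e) = inj₂ e
  adj-sym (inj₂ e) = inj₁ e

  -- every edge joins a vertex to its parent, which has a smaller index
  adj-toℕ-≢ : ∀ {u v} → Adj T u v → toℕ u ≢ toℕ v
  adj-toℕ-≢ (inj₁ (i , refl , refl)) e = ℕP.<-irrefl (sym e) (ℕ.s≤s (parent< i))
  adj-toℕ-≢ (inj₂ (i , refl , refl)) e = ℕP.<-irrefl e (ℕ.s≤s (parent< i))

  adj-≢ : ∀ {u v} → Adj T u v → u ≢ v
  adj-≢ uv refl = adj-toℕ-≢ uv refl

  lower-neighbour-unique : ∀ {p q m} → Adj T p m → Adj T q m →
                           toℕ p ℕ.< toℕ m → toℕ q ℕ.< toℕ m → p ≡ q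
  lower-neighbour-unique pm qm p<m q<m with below pm p<m | below qm q<m
    where
    below : ∀ {p m} → Adj T p m → toℕ p ℕ.< toℕ m → ∃[ i ] (m ≡ fs i × p ≡ parent i)
    below (inj₁ (i , refl , refl)) p<m =
      ⊥-elim (ℕP.<-asym p<m (ℕ.s≤s (parent< i)))
    below (inj₂ (i , refl , refl)) _ = i , refl , refl
  ... | i , refl , refl | j , m≡fs-j , refl = cong parent (FP.suc-injective m≡fs-j)

  -- trees contain no triangles: the vertex of largest index would have two lower neighbours
  triangle-free : ∀ {x a b} → Adj T x a → Adj T x b → ¬ Adj T a b
  triangle-free {x} {a} {b} xa xb ab
    with largest-of-three (toℕ x) (toℕ a) (toℕ b) (adj-toℕ-≢ xa) (adj-toℕ-≢ ab) (adj-toℕ-≢ xb)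
  ... | inj₁ (a<x , b<x) = adj-≢ ab (lower-neighbour-unique (adj-sym xa) (adj-sym xb) a<x b<x)
  ... | inj₂ (inj₁ (x<a , b<a)) = adj-≢ xb (lower-neighbour-unique xa (adj-sym ab) x<a b<a)
  ... | inj₂ (inj₂ (x<b , a<b)) = adj-≢ xa (lower-neighbour-unique xb ab x<b a<b)

  adj? : ∀ u v → Dec (Adj T u v)
  adj? u v = child-of? u v ⊎-dec child-of? v u
    where
    child-of? : ∀ u v → Dec (∃[ i ] (u ≡ fs i × v ≡ parent i))
    child-of? fz v = no λ { (i , () , _) }
    child-of? (fs i) v with v F.≟ parent i
    ... | yes v≡p = yes (i , refl , v≡p)
    ... | no v≢p = no λ { (j , refl , v≡p) → v≢p v≡p }

  has-neighbour : 1 ≤ n → ∀ x → ∃[ y ] Adj T x y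
  has-neighbour _ (fs i) = parent i , inj₁ (i , refl , refl)
  has-neighbour 1≤n fz = fs i , inj₂ (i , refl , sym parent≡root)
    where
    i = F.fromℕ< 1≤n
    parent≡root : parent i ≡ fz
    parent≡root = FP.toℕ-injective
      (ℕP.n≤0⇒n≡0 (ℕP.≤-trans (parent< i) (ℕP.≤-reflexive (FP.toℕ-fromℕ< 1≤n))))

  two-neighbours : 1 ≤ n → ∀ x → ¬ IsLeaf T x →
                   ∃[ y₁ ] ∃[ y₂ ] (Adj T x y₁ × Adj T x y₂ × y₁ ≢ y₂)
  two-neighbours 1≤n x not-leaf with has-neighbour 1≤n x
  ... | y , xy with FP.all? (λ w → adj? x w →-dec (w F.≟ y))
  ...   | yes only-y = ⊥-elim (not-leaf (y , xy , only-y))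
  ...   | no not-only-y with FP.¬∀⟶∃¬ _ _ (λ w → adj? x w →-dec (w F.≟ y)) not-only-y
  ...     | w , w-breaks with adj? x w | w F.≟ y
  ...       | yes xw | no w≢y = y , w , xy , xw , λ y≡w → w≢y (sym y≡w)
  ...       | yes _  | yes w≡y = ⊥-elim (w-breaks (λ _ → w≡y))
  ...       | no ¬xw | _ = ⊥-elim (w-breaks (λ xw → ⊥-elim (¬xw xw)))

  moves : ℕ → V T → V T → Dist T → Dist T
  moves ℕ.zero u v D = D
  moves (ℕ.suc m) u v D = applyMove T u v (moves m u v D)

  moves-source : ∀ m {u v} D → moves m u v D u ≡ D u ℕ.∸ m ℕ.* 2
  moves-source ℕ.zero D = refl
  moves-source (ℕ.suc m) {u} {v} D = begin
    moves (ℕ.suc m) u v D u         ≡⟨ if-≡ {w = u} refl ⟩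
    moves m u v D u ℕ.∸ 2           ≡⟨ cong (ℕ._∸ 2) (moves-source m D) ⟩
    D u ℕ.∸ m ℕ.* 2 ℕ.∸ 2           ≡⟨ ℕP.∸-+-assoc (D u) (m ℕ.* 2) 2 ⟩
    D u ℕ.∸ (m ℕ.* 2 ℕ.+ 2)         ≡⟨ cong (D u ℕ.∸_) (ℕP.+-comm (m ℕ.* 2) 2) ⟩
    D u ℕ.∸ (ℕ.suc m ℕ.* 2)         ∎
    where open ≡-Reasoning

  moves-target : ∀ m {u v} D → u ≢ v → moves m u v D v ≡ D v ℕ.+ m
  moves-target ℕ.zero D _ = sym (ℕP.+-identityʳ _)
  moves-target (ℕ.suc m) {u} {v} D u≢v =
    trans (if-≢ (λ v≡u → u≢v (sym v≡u)))
      (trans (if-≡ {w = v} refl) (trans (cong ℕ.suc (moves-target m D u≢v)) (sym (ℕP.+-suc (D v) m))))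

  moves-other : ∀ m {u v w} D → w ≢ u → w ≢ v → moves m u v D w ≡ D w
  moves-other ℕ.zero D _ _ = refl
  moves-other (ℕ.suc m) D w≢u w≢v = trans (if-≢ w≢u) (trans (if-≢ w≢v) (moves-other m D w≢u w≢v))

  moves-reachable : ∀ m {u v} D → Adj T u v → m ℕ.* 2 ≤ D u → Star (Move T) D (moves m u v D)
  moves-reachable ℕ.zero D _ _ = ε
  moves-reachable (ℕ.suc m) {u} {v} D uv enough =
    moves-reachable m D uv (ℕP.≤-trans (ℕP.m≤n+m (m ℕ.* 2) 2) enough) ◅◅
    (move u v uv (subst (2 ≤_) (sym (moves-source m D)) (ℕP.m+n≤o⇒m≤o∸n 2 enough)) ◅ ε)

  State : Set
  State = (V T → Bool) × (V T → ℤ)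

  -- Deleting a leaf v of the current vertex set S whose only remaining
  -- neighbour is u.  Unlike  Delete  this may delete any leaf.
  data Del : State → State → Set where
    del : ∀ S C v u → S v ≡ true → Adj T v u → S u ≡ true →
          (∀ w → Adj T v w → S w ≡ true → w ≡ u) →
          Del (S , C) (removeV T v S , addAt T u (push (C v)) C)

  removeV-true : ∀ {v w} {S : V T → Bool} → removeV T v S w ≡ true → w ≢ v × S w ≡ true
  removeV-true {v} {w} e with w F.≟ v
  ... | no w≢v = w≢v , e

  removeV-false : ∀ {v w} {S : V T → Bool} → removeV T v S w ≡ false → w ≡ v ⊎ S w ≡ false
  removeV-false {v} {w} e with w F.≟ v
  ... | yes w≡v = inj₁ w≡v
  ... | no _ = inj₂ e

  Sufficient : State → Set
  Sufficient (S , C) = ∀ (ω D : V T → ℕ) → (∀ w → S w ≡ true → C w ℤ.+ + ω w ≤ℤ + D w) →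
                       (∀ w → S w ≡ false → ω w ≤ D w) → Solvable T ω D

  solvable-via : ∀ {ω D D₁} → Star (Move T) D D₁ → Solvable T ω D₁ → Solvable T ω D
  solvable-via D→D₁ (D* , D₁→D* , D*≥ω) = D* , D→D₁ ◅◅ D₁→D* , D*≥ω

  -- Deleting a leaf v with surplus k: first pass ⌊k/2⌋ pebbles from v to u.
  sufficient-surplus : ∀ {S C v u} k → C v ≡ + k → S v ≡ true → Adj T v u → S u ≡ true →
                       Sufficient (removeV T v S , addAt T u (+ (k ℕ./ 2)) C) → Sufficient (S , C)
  sufficient-surplus {S} {C} {v} {u} k Cv≡k Sv vu Su next ω D onS offS =
    solvable-via (moves-reachable m D vu v-has-2m) (next ω (moves m v u D) onS′ offS′)
    where
    m = k ℕ./ 2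
    v-rich : k ℕ.+ ω v ≤ D v
    v-rich = ℤP.drop‿+≤+ (subst (λ c → c ℤ.+ + ω v ≤ℤ + D v) Cv≡k (onS v Sv))
    onS′ : ∀ w → removeV T v S w ≡ true → addAt T u (+ m) C w ℤ.+ + ω w ≤ℤ + moves m v u D w
    onS′ w e with removeV-true {S = S} e
    ... | w≢v , Sw with w F.≟ u
    ...   | yes refl = begin
      (C u ℤ.+ + m) ℤ.+ + ω u   ≡⟨ swap (C u) (+ m) (+ ω u) ⟩
      (C u ℤ.+ + ω u) ℤ.+ + m   ≤⟨ ℤP.+-monoˡ-≤ (+ m) (onS u Su) ⟩
      + (D u ℕ.+ m)             ≡⟨ cong +_ (sym (moves-target m D (adj-≢ vu))) ⟩
      + moves m v u D u         ∎
      where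
      open ℤP.≤-Reasoning
      swap : ∀ a b c → (a ℤ.+ b) ℤ.+ c ≡ (a ℤ.+ c) ℤ.+ b
      swap = solve-∀
    ...   | no w≢u = subst (λ d → C w ℤ.+ + ω w ≤ℤ + d) (sym (moves-other m D w≢v w≢u)) (onS w Sw)
    offS′ : ∀ w → removeV T v S w ≡ false → ω w ≤ moves m v u D w
    offS′ w e with removeV-false {S = S} e
    ... | inj₁ refl = subst (ω v ≤_) (sym (moves-source m D))
                        (ℕP.m+n≤o⇒m≤o∸n (ω v) (begin
                          ω v ℕ.+ m ℕ.* 2   ≡⟨ ℕP.+-comm (ω v) (m ℕ.* 2) ⟩
                          m ℕ.* 2 ℕ.+ ω v   ≤⟨ ℕP.+-monoˡ-≤ (ω v) (ℕD.m/n*n≤m k 2) ⟩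
                          k ℕ.+ ω v         ≤⟨ v-rich ⟩
                          D v               ∎))
      where open ℕP.≤-Reasoning
    ... | inj₂ Sw≡false = subst (ω w ≤_) (sym (moves-other m D w≢v w≢u)) (offS w Sw≡false)
      where
      w≢v : w ≢ v
      w≢v refl = live-not-dead Sv Sw≡false
      w≢u : w ≢ u
      w≢u refl = live-not-dead Su Sw≡false
    v-has-2m : m ℕ.* 2 ≤ D v
    v-has-2m = ℕP.≤-trans (ℕD.m/n*n≤m k 2) (ℕP.≤-trans (ℕP.m≤m+n k (ω v)) v-rich)

  reroute : V T → V T → ℕ → (V T → ℕ) → V T → ℕ
  reroute u v m ω w =
    if ⌊ w F.≟ u ⌋ then ω u ℕ.+ m ℕ.* 2 else (if ⌊ w F.≟ v ⌋ then ω v ℕ.∸ m else ω w)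

  reroute-v : ∀ {u v} m ω → u ≢ v → reroute u v m ω v ≡ ω v ℕ.∸ m
  reroute-v {v = v} m ω u≢v = trans (if-≢ (λ v≡u → u≢v (sym v≡u))) (if-≡ {w = v} refl)

  reroute-other : ∀ {u v w} m ω → w ≢ u → w ≢ v → reroute u v m ω w ≡ ω w
  reroute-other m ω w≢u w≢v = trans (if-≢ w≢u) (if-≢ w≢v)

  reroute-solvable : ∀ {u v} m ω D → Adj T u v → Solvable T (reroute u v m ω) D → Solvable T ω D
  reroute-solvable {u} {v} m ω D uv (D* , D→D* , D*≥ω′) =
    moves m u v D* , D→D* ◅◅ moves-reachable m D* uv (ℕP.m+n≤o⇒n≤o (ω u) u-rich) , covered
    where
    u-rich : ω u ℕ.+ m ℕ.* 2 ≤ D* u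
    u-rich = subst (_≤ D* u) (if-≡ {w = u} refl) (D*≥ω′ u)
    covered : ∀ w → ω w ≤ moves m u v D* w
    covered w = by-cases (w F.≟ u) (w F.≟ v)
      where
      by-cases : Dec (w ≡ u) → Dec (w ≡ v) → ω w ≤ moves m u v D* w
      by-cases (yes refl) _ = subst (ω u ≤_) (sym (moves-source m D*)) (ℕP.m+n≤o⇒m≤o∸n (ω u) u-rich)
      by-cases (no _) (yes refl) = subst (ω v ≤_) (sym (moves-target m D* (adj-≢ uv))) (begin
        ω v                   ≤⟨ ℕP.m≤n+m∸n (ω v) m ⟩
        m ℕ.+ (ω v ℕ.∸ m)     ≤⟨ ℕP.+-monoʳ-≤ m (subst (_≤ D* v) (reroute-v m ω (adj-≢ uv)) (D*≥ω′ v)) ⟩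
        m ℕ.+ D* v            ≡⟨ ℕP.+-comm m (D* v) ⟩
        D* v ℕ.+ m            ∎)
        where open ℕP.≤-Reasoning
      by-cases (no w≢u) (no w≢v) =
        subst₂ _≤_ (reroute-other m ω w≢u w≢v) (sym (moves-other m D* w≢u w≢v)) (D*≥ω′ w)

  -- Deleting a leaf v with deficit m = k + 1: the reduced problem asks u
  -- for 2m extra pebbles, which m moves from u to v then spend on v.
  sufficient-deficit : ∀ {S C v u} k → C v ≡ -[1+ k ] → S v ≡ true → Adj T v u → S u ≡ true →
                       Sufficient (removeV T v S , addAt T u (push -[1+ k ]) C) → Sufficient (S , C)
  sufficient-deficit {S} {C} {v} {u} k Cv≡-m Sv vu Su next ω D onS offS =
    reroute-solvable m ω D (adj-sym vu) (next (reroute u v m ω) D onS′ offS′)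
    where
    m = ℕ.suc k
    v-poor : ω v ≤ m ℕ.+ D v
    v-poor = ℤP.drop‿+≤+ (begin
      + ω v                               ≡⟨ cancel (+ m) (+ ω v) ⟩
      (-[1+ k ] ℤ.+ + ω v) ℤ.+ + m        ≤⟨ ℤP.+-monoˡ-≤ (+ m) v-covered ⟩
      + D v ℤ.+ + m                       ≡⟨ ℤP.+-comm (+ D v) (+ m) ⟩
      + (m ℕ.+ D v)                       ∎)
      where
      open ℤP.≤-Reasoning
      v-covered : -[1+ k ] ℤ.+ + ω v ≤ℤ + D v
      v-covered = subst (λ c → c ℤ.+ + ω v ≤ℤ + D v) Cv≡-m (onS v Sv)
      cancel : ∀ M b → b ≡ (ℤ.- M ℤ.+ b) ℤ.+ M
      cancel = solve-∀
    onS′ : ∀ w → removeV T v S w ≡ true → addAt T u (push -[1+ k ]) C w ℤ.+ + reroute u v m ω w ≤ℤ + D w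
    onS′ w e with removeV-true {S = S} e
    ... | w≢v , Sw with w F.≟ u
    ...   | yes refl = subst (_≤ℤ + D u) (sym u-balanced) (onS u Su)
      where
      -- the 2m pebbles demanded at u exactly offset the debt pushed onto it
      u-balanced : (C u ℤ.+ push -[1+ k ]) ℤ.+ (+ ω u ℤ.+ + (m ℕ.* 2)) ≡ C u ℤ.+ + ω u
      u-balanced = begin
        (C u ℤ.+ push -[1+ k ]) ℤ.+ (+ ω u ℤ.+ + (m ℕ.* 2))   ≡⟨ regroup (C u) (push -[1+ k ]) (+ ω u) (+ (m ℕ.* 2)) ⟩
        (C u ℤ.+ + ω u) ℤ.+ (push -[1+ k ] ℤ.+ + (m ℕ.* 2))   ≡⟨ cong (λ z → (C u ℤ.+ + ω u) ℤ.+ z) (push-deficit k) ⟩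
        (C u ℤ.+ + ω u) ℤ.+ + 0                               ≡⟨ ℤP.+-identityʳ _ ⟩
        C u ℤ.+ + ω u                                         ∎
        where
        open ≡-Reasoning
        regroup : ∀ c p o r → (c ℤ.+ p) ℤ.+ (o ℤ.+ r) ≡ (c ℤ.+ o) ℤ.+ (p ℤ.+ r)
        regroup = solve-∀
    ...   | no w≢u = subst (λ o → C w ℤ.+ + o ≤ℤ + D w) (sym (if-≢ w≢v)) (onS w Sw)
    offS′ : ∀ w → removeV T v S w ≡ false → reroute u v m ω w ≤ D w
    offS′ w e with removeV-false {S = S} e
    ... | inj₁ refl = subst (_≤ D v) (sym (reroute-v m ω (adj-≢ (adj-sym vu)))) (ℕP.m≤n+o⇒m∸n≤o (ω v) m v-poor)
    ... | inj₂ Sw≡false = subst (_≤ D w) (sym (reroute-other m ω w≢u w≢v)) (offS w Sw≡false)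
      where
      w≢v : w ≢ v
      w≢v refl = live-not-dead Sv Sw≡false
      w≢u : w ≢ u
      w≢u refl = live-not-dead Su Sw≡false

  sufficient-step : ∀ {s s′} → Del s s′ → Sufficient s′ → Sufficient s
  sufficient-step (del S C v u Sv vu Su _) with C v in Cv≡
  ... | + k = sufficient-surplus k Cv≡ Sv vu Su
  ... | -[1+ k ] = sufficient-deficit k Cv≡ Sv vu Su

  sufficient-chain : ∀ {s s′} → Star Del s s′ → Sufficient s′ → Sufficient s
  sufficient-chain ε enough = enough
  sufficient-chain (d ◅ ds) enough = sufficient-step d (sufficient-chain ds enough)

  Single : (V T → Bool) → V T → Set
  Single S x = (∀ w → S w ≡ true → w ≡ x) × S x ≡ true

  ReducesTo : State → V T → ℤ → Set
  ReducesTo s x c = ∃[ S ] ∃[ C ] (Star Del s (S , C) × Single S x × C x ≡ c)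

  all-live : V T → Bool
  all-live _ = true

  excess-+-target : ∀ (D ω : V T → ℕ) w → excess T D ω w ℤ.+ + ω w ≡ + D w
  excess-+-target D ω w = cancel (+ D w) (+ ω w)
    where
    cancel : ∀ d o → (d ℤ.- o) ℤ.+ o ≡ d
    cancel = solve-∀

  reduction-sufficient : ∀ (ω D : V T → ℕ) {x c} → ReducesTo (all-live , excess T D ω) x c →
                         + 0 ≤ℤ c → Solvable T ω D
  reduction-sufficient ω D {x} (S , C , chain , (only-x , _) , refl) 0≤Cx =
    sufficient-chain chain single-sufficient ω D (λ w _ → ℤP.≤-reflexive (excess-+-target D ω w)) (λ _ ())
    where
    single-sufficient : Sufficient (S , C)
    single-sufficient ω D onS offS = D , ε , covered
      where
      covered : ∀ w → ω w ≤ D w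
      covered w with S w in Sw
      ... | false = offS w Sw
      ... | true with only-x w Sw
      ...   | refl = ℤP.drop‿+≤+ (ℤP.≤-trans (ℤP.+-monoˡ-≤ (+ ω x) 0≤Cx) (onS x Sw))

  data Below (S : V T → Bool) (C₁ C : V T → ℤ) : Set where
    pointwise : (∀ w → S w ≡ true → C₁ w ≤ℤ C w) → Below S C₁ C
    one-move : ∀ u v → Adj T u v → S u ≡ true → S v ≡ true →
               C₁ u ≤ℤ C u ℤ.- + 2 → C₁ v ≤ℤ C v ℤ.+ + 1 →
               (∀ w → S w ≡ true → w ≢ u → w ≢ v → C₁ w ≤ℤ C w) → Below S C₁ C

  addAt-≤ : ∀ {u w : V T} {C₁ C : V T → ℤ} {p₁ p} e → C₁ w ≤ℤ C w ℤ.+ e → p₁ ≤ℤ p →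
            addAt T u p₁ C₁ w ≤ℤ addAt T u p C w ℤ.+ e
  addAt-≤ {u} {w} {C₁} {C} {p₁} {p} e C₁≤C p₁≤p with w F.≟ u
  ... | yes refl = begin
    C₁ u ℤ.+ p₁           ≤⟨ ℤP.+-mono-≤ C₁≤C p₁≤p ⟩
    (C u ℤ.+ e) ℤ.+ p     ≡⟨ swap (C u) e p ⟩
    (C u ℤ.+ p) ℤ.+ e     ∎
    where
    open ℤP.≤-Reasoning
    swap : ∀ a b c → (a ℤ.+ b) ℤ.+ c ≡ (a ℤ.+ c) ℤ.+ b
    swap = solve-∀
  ... | no _ = C₁≤C

  addAt-≤₀ : ∀ {u w : V T} {C₁ C : V T → ℤ} {p₁ p} → C₁ w ≤ℤ C w → p₁ ≤ℤ p →
             addAt T u p₁ C₁ w ≤ℤ addAt T u p C w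
  addAt-≤₀ {u} {w} {C₁} {C} {p₁} {p} C₁≤C p₁≤p =
    subst (addAt T u p₁ C₁ w ≤ℤ_) (ℤP.+-identityʳ _)
      (addAt-≤ {u} {w} {C₁} {C} (+ 0) (subst (C₁ w ≤ℤ_) (sym (ℤP.+-identityʳ _)) C₁≤C) p₁≤p)

  -- If the deleted leaf v is an end of the recorded move, the move is
  -- absorbed: it suffices to compare the new values at u.
  absorb : ∀ {S C₁ C v u} → (∀ w → S w ≡ true → w ≢ v → w ≢ u → C₁ w ≤ℤ C w) →
           C₁ u ℤ.+ push (C₁ v) ≤ℤ C u ℤ.+ push (C v) →
           Below (removeV T v S) (addAt T u (push (C₁ v)) C₁) (addAt T u (push (C v)) C)
  absorb {S} {C₁} {C} {v} {u} elsewhere at-u = pointwise compare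
    where
    compare : ∀ w → removeV T v S w ≡ true → addAt T u (push (C₁ v)) C₁ w ≤ℤ addAt T u (push (C v)) C w
    compare w live with removeV-true {S = S} live
    ... | w≢v , Sw with w F.≟ u
    ...   | yes refl = at-u
    ...   | no w≢u = elsewhere w Sw w≢v w≢u

  below-step : ∀ {S C S′ C′} C₁ → Del (S , C) (S′ , C′) → Below S C₁ C →
               ∃[ C₁′ ] (Del (S , C₁) (S′ , C₁′) × Below S′ C₁′ C′)
  below-step C₁ (del S C v u Sv vu Su only-u) below =
    addAt T u (push (C₁ v)) C₁ , del S C₁ v u Sv vu Su only-u , after below
    where
    after : Below S C₁ C → Below (removeV T v S) (addAt T u (push (C₁ v)) C₁) (addAt T u (push (C v)) C)
    after (pointwise C₁≤C) = pointwise λ w live →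
      addAt-≤₀ {u} {w} {C₁} {C} (C₁≤C w (proj₂ (removeV-true {S = S} live))) (push-mono (C₁≤C v Sv))
    after (one-move u₀ v₀ u₀v₀ Su₀ Sv₀ source target elsewhere) = by-cases (v F.≟ u₀) (v F.≟ v₀)
      where
      by-cases : Dec (v ≡ u₀) → Dec (v ≡ v₀) →
                 Below (removeV T v S) (addAt T u (push (C₁ v)) C₁) (addAt T u (push (C v)) C)
      -- deleting the source of the move: its surplus was pushed towards the target u
      by-cases (yes refl) _ with only-u v₀ u₀v₀ Sv₀
      ... | refl = absorb (λ w Sw w≢v w≢u → elsewhere w Sw w≢v w≢u)
                     (trade-slack {C₁ u} {C u} {push (C₁ v)} {push (C v)} {+ 1} target
                        (ℤP.≤-trans (push-+2 (C₁ v)) (push-mono (slack-move {C₁ v} {C v} {ℤ.- + 2} source))))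
      -- deleting the target of the move: its gain came from the source u
      by-cases (no _) (yes refl) with only-u u₀ (adj-sym u₀v₀) Su₀
      ... | refl = absorb (λ w Sw w≢v w≢u → elsewhere w Sw w≢u w≢v)
                     (trade-slack {C₁ u} {C u} {push (C₁ v)} {push (C v)} {ℤ.- + 2} source
                        (slack-move {push (C₁ v)} {push (C v)} {+ 2} (ℤP.≤-trans (push-mono target) (push-+1 (C v)))))
      by-cases (no v≢u₀) (no v≢v₀) =
        one-move u₀ v₀ u₀v₀ (still-live v≢u₀ Su₀) (still-live v≢v₀ Sv₀)
          (addAt-≤ {u} {u₀} {C₁} {C} _ source push-v) (addAt-≤ {u} {v₀} {C₁} {C} _ target push-v)
          (λ w live w≢u₀ w≢v₀ → addAt-≤₀ {u} {w} {C₁} {C}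
             (elsewhere w (proj₂ (removeV-true {S = S} live)) w≢u₀ w≢v₀) push-v)
        where
        push-v : push (C₁ v) ≤ℤ push (C v)
        push-v = push-mono (elsewhere v Sv (λ v≡u₀ → v≢u₀ v≡u₀) (λ v≡v₀ → v≢v₀ v≡v₀))
        still-live : ∀ {w} → v ≢ w → S w ≡ true → removeV T v S w ≡ true
        still-live v≢w Sw = trans (if-≢ (λ w≡v → v≢w (sym w≡v))) Sw

  below-chain : ∀ {S C Sf Cf} C₁ → Star Del (S , C) (Sf , Cf) → Below S C₁ C →
                ∃[ Cf₁ ] (Star Del (S , C₁) (Sf , Cf₁) × Below Sf Cf₁ Cf)
  below-chain C₁ ε below = C₁ , ε , below
  below-chain C₁ (d ◅ ds) below with below-step C₁ d below
  ... | C₁′ , d₁ , below′ with below-chain C₁′ ds below′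
  ...   | Cf₁ , ds₁ , below-f = Cf₁ , d₁ ◅ ds₁ , below-f

  -- once only x is alive, a recorded move is impossible, so domination holds at x
  below-single : ∀ {S C₁ C x} → Below S C₁ C → Single S x → C₁ x ≤ℤ C x
  below-single (pointwise C₁≤C) (_ , Sx) = C₁≤C _ Sx
  below-single (one-move u v uv Su Sv _ _ _) (only-x , _) with only-x u Su | only-x v Sv
  ... | refl | refl = ⊥-elim (adj-≢ uv refl)

  nonneg-chain : ∀ {S C Sf Cf} → Star Del (S , C) (Sf , Cf) →
                 (∀ w → S w ≡ true → + 0 ≤ℤ C w) → ∀ w → Sf w ≡ true → + 0 ≤ℤ Cf w
  nonneg-chain ε nonneg = nonneg
  nonneg-chain (del S C v u Sv _ Su _ ◅ ds) nonneg = nonneg-chain ds nonneg′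
    where
    nonneg′ : ∀ w → removeV T v S w ≡ true → + 0 ≤ℤ addAt T u (push (C v)) C w
    nonneg′ w live with w F.≟ u
    ... | yes refl = ℤP.+-mono-≤ (nonneg u Su) (push-nonneg (nonneg v Sv))
    ... | no _ = nonneg w (proj₂ (removeV-true {S = S} live))

  move-below : ∀ (ω D : V T → ℕ) {u v} → Adj T u v → 2 ≤ D u →
               Below all-live (excess T (applyMove T u v D) ω) (excess T D ω)
  move-below ω D {u} {v} uv 2≤Du =
    one-move u v uv refl refl (ℤP.≤-reflexive at-u) (ℤP.≤-reflexive at-v)
      (λ w _ w≢u w≢v → ℤP.≤-reflexive (cong (λ d → + d ℤ.- + ω w) (trans (if-≢ w≢u) (if-≢ w≢v))))
    where
    open ≡-Reasoning
    at-u : excess T (applyMove T u v D) ω u ≡ excess T D ω u ℤ.- + 2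
    at-u = begin
      + applyMove T u v D u ℤ.- + ω u    ≡⟨ cong (λ d → + d ℤ.- + ω u) (if-≡ {w = u} refl) ⟩
      + (D u ℕ.∸ 2) ℤ.- + ω u            ≡⟨ cong (ℤ._- + ω u) (sym (trans (ℤP.m-n≡m⊖n (D u) 2) (ℤP.⊖-≥ 2≤Du))) ⟩
      (+ D u ℤ.- + 2) ℤ.- + ω u          ≡⟨ swap (+ D u) (+ 2) (+ ω u) ⟩
      (+ D u ℤ.- + ω u) ℤ.- + 2          ∎
      where
      swap : ∀ d t o → (d ℤ.- t) ℤ.- o ≡ (d ℤ.- o) ℤ.- t
      swap = solve-∀
    at-v : excess T (applyMove T u v D) ω v ≡ excess T D ω v ℤ.+ + 1
    at-v = begin
      + applyMove T u v D v ℤ.- + ω v    ≡⟨ cong (λ d → + d ℤ.- + ω v) gained ⟩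
      (+ 1 ℤ.+ + D v) ℤ.- + ω v          ≡⟨ swap (+ D v) (+ ω v) ⟩
      (+ D v ℤ.- + ω v) ℤ.+ + 1          ∎
      where
      gained : applyMove T u v D v ≡ ℕ.suc (D v)
      gained = trans (if-≢ (λ v≡u → adj-≢ uv (sym v≡u))) (if-≡ {w = v} refl)
      swap : ∀ d o → (+ 1 ℤ.+ d) ℤ.- o ≡ (d ℤ.- o) ℤ.+ + 1
      swap = solve-∀

  -- Each pebbling move can only
  -- lower the final value, and at the end all values are nonnegative.
  reduction-necessary : ∀ (ω : V T → ℕ) {D D*} → Star (Move T) D D* → (∀ w → ω w ≤ D* w) →
                        ∀ {x c} → ReducesTo (all-live , excess T D ω) x c → + 0 ≤ℤ c
  reduction-necessary ω {D} ε D≥ω (S , C , chain , (_ , Sx) , refl) =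
    nonneg-chain chain (λ w _ → ℤP.i≤j⇒0≤j-i (ℤ.+≤+ (D≥ω w))) _ Sx
  reduction-necessary ω {D} (move u v uv 2≤Du ◅ rest) D*≥ω (S , C , chain , single , refl)
    with below-chain (excess T (applyMove T u v D) ω) chain (move-below ω D uv 2≤Du)
  ... | C₁ , chain₁ , below =
    ℤP.≤-trans (reduction-necessary ω rest D*≥ω (S , C₁ , chain₁ , single , refl)) (below-single below single)

  Delete⇒Del : ∀ {x s s′} → Star (Delete T x) s s′ → Star Del s s′
  Delete⇒Del ε = ε
  Delete⇒Del (delete S C v u Sv _ vu Su only-u ◅ ds) = del S C v u Sv vu Su only-u ◅ Delete⇒Del ds

  -- Deleting leaves outside T_x never changes the value at x,
  -- since a deleted leaf is never adjacent to x.
  delete-fixes-centre : ∀ {x S C Sf Cf} → Star (Delete T x) (S , C) (Sf , Cf) → Cf x ≡ C x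
  delete-fixes-centre ε = refl
  delete-fixes-centre {x} (delete S C v u Sv v∉Tx vu Su _ ◅ ds) =
    trans (delete-fixes-centre ds) (if-≢ x≢u)
    where
    x≢u : x ≢ u
    x≢u refl = v∉Tx (inj₂ (adj-sym vu))

  -- Adding to C a function Δ supported on T_x adds Δ to the induced
  -- distribution: the deleted leaves keep their values.
  induced-shift : ∀ {x S C Sf Cf} → Star (Delete T x) (S , C) (Sf , Cf) →
                  ∀ (C′ Δ : V T → ℤ) → (∀ w → C′ w ≡ C w ℤ.+ Δ w) →
                  (∀ w → ¬ InTx T x w → Δ w ≡ + 0) →
                  ∃[ Cf′ ] (Star (Delete T x) (S , C′) (Sf , Cf′) × (∀ w → Cf′ w ≡ Cf w ℤ.+ Δ w))
  induced-shift ε C′ Δ C′≡C+Δ _ = C′ , ε , C′≡C+Δ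
  induced-shift (delete S C v u Sv v∉Tx vu Su only-u ◅ ds) C′ Δ C′≡C+Δ outside
    with induced-shift ds (addAt T u (push (C′ v)) C′) Δ shifted outside
    where
    same-push : push (C′ v) ≡ push (C v)
    same-push = cong push (trans (C′≡C+Δ v) (trans (cong (λ d → C v ℤ.+ d) (outside v v∉Tx)) (ℤP.+-identityʳ (C v))))
    shifted : ∀ w → addAt T u (push (C′ v)) C′ w ≡ addAt T u (push (C v)) C w ℤ.+ Δ w
    shifted w with w F.≟ u
    ... | yes refl = trans (cong₂ ℤ._+_ (C′≡C+Δ u) same-push) (swap (C u) (Δ u) (push (C v)))
      where
      swap : ∀ a b c → (a ℤ.+ b) ℤ.+ c ≡ (a ℤ.+ c) ℤ.+ b
      swap = solve-∀
    ... | no _ = C′≡C+Δ w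
  ... | Cf′ , ds′ , Cf′≡Cf+Δ = Cf′ , delete S C′ v u Sv v∉Tx vu Su only-u ◅ ds′ , Cf′≡Cf+Δ

  neighbourPush : V T → (V T → ℤ) → V T → ℤ
  neighbourPush x C y with adj? x y
  ... | yes _ = push (C y)
  ... | no _ = + 0

  neighbourPush-adj : ∀ {x y} (C : V T → ℤ) → Adj T x y → neighbourPush x C y ≡ push (C y)
  neighbourPush-adj {x} {y} C xy with adj? x y
  ... | yes _ = refl
  ... | no ¬xy = ⊥-elim (¬xy xy)

  neighbourPush-cong : ∀ {x} {C C′ : V T → ℤ} y → (y ≢ x → C′ y ≡ C y) →
                       neighbourPush x C′ y ≡ neighbourPush x C y
  neighbourPush-cong {x} y C′≡C with adj? x y
  ... | yes xy = cong push (C′≡C (λ y≡x → adj-≢ xy (sym y≡x)))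
  ... | no _ = refl

  -- If only x and neighbours of x are live, x is the only live neighbour of
  -- each neighbour y of x, since T has no triangles.
  star-leaf : ∀ {x y} {S : V T → Bool} {P : V T → Set} → (∀ w → S w ≡ true → w ≡ x ⊎ (Adj T x w × P w)) →
              Adj T x y → ∀ w → Adj T y w → S w ≡ true → w ≡ x
  star-leaf inside xy w yw Sw with inside w Sw
  ... | inj₁ w≡x = w≡x
  ... | inj₂ (xw , _) = ⊥-elim (triangle-free xy xw yw)

  collapse : ∀ x (L : List (V T)) → Unique L → ∀ S C →
             (∀ w → S w ≡ true → w ≡ x ⊎ (Adj T x w × w ∈ L)) →
             (∀ w → Adj T x w → w ∈ L → S w ≡ true) → S x ≡ true →
             ReducesTo (S , C) x (C x ℤ.+ ∑ L (neighbourPush x C))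
  collapse x [] [] S C inside _ Sx = S , C , ε , (only-x , Sx) , sym (ℤP.+-identityʳ (C x))
    where
    only-x : ∀ w → S w ≡ true → w ≡ x
    only-x w Sw with inside w Sw
    ... | inj₁ w≡x = w≡x
  collapse x (y ∷ L) (y∉L ∷ unique) S C inside complete Sx with adj? x y
  ... | no ¬xy with collapse x L unique S C inside′ (λ w xw w∈L → complete w xw (there w∈L)) Sx
    where
    inside′ : ∀ w → S w ≡ true → w ≡ x ⊎ (Adj T x w × w ∈ L)
    inside′ w Sw with inside w Sw
    ... | inj₁ w≡x = inj₁ w≡x
    ... | inj₂ (xw , here refl) = ⊥-elim (¬xy xw)
    ... | inj₂ (xw , there w∈L) = inj₂ (xw , w∈L)
  ...   | Sf , Cf , chain , single , value =
    Sf , Cf , chain , single , trans value (cong (λ Σ → C x ℤ.+ Σ) (sym (ℤP.+-identityˡ _)))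
  collapse x (y ∷ L) (y∉L ∷ unique) S C inside complete Sx | yes xy
    with collapse x L unique (removeV T y S) (addAt T x (push (C y)) C) inside′ complete′ Sx′
    where
    inside′ : ∀ w → removeV T y S w ≡ true → w ≡ x ⊎ (Adj T x w × w ∈ L)
    inside′ w live with removeV-true {S = S} live
    ... | w≢y , Sw with inside w Sw
    ...   | inj₁ w≡x = inj₁ w≡x
    ...   | inj₂ (_ , here refl) = ⊥-elim (w≢y refl)
    ...   | inj₂ (xw , there w∈L) = inj₂ (xw , w∈L)
    complete′ : ∀ w → Adj T x w → w ∈ L → removeV T y S w ≡ true
    complete′ w xw w∈L = trans (if-≢ (λ w≡y → All.lookup y∉L w∈L (sym w≡y))) (complete w xw (there w∈L))
    Sx′ : removeV T y S x ≡ true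
    Sx′ = trans (if-≢ (adj-≢ xy)) Sx
  ... | Sf , Cf , chain , single , value =
    Sf , Cf , del S C y x (complete y xy (here refl)) (adj-sym xy) Sx (star-leaf inside xy) ◅ chain ,
    single , trans value gathered
    where
    gathered : addAt T x (push (C y)) C x ℤ.+ ∑ L (neighbourPush x (addAt T x (push (C y)) C))
               ≡ C x ℤ.+ (push (C y) ℤ.+ ∑ L (neighbourPush x C))
    gathered = trans (cong₂ ℤ._+_ (if-≡ {w = x} refl)
                       (∑-cong L (λ {w} _ → neighbourPush-cong {x} {C} {addAt T x (push (C y)) C} w if-≢)))
                 (ℤP.+-assoc (C x) (push (C y)) _)

  vertices : List (V T)
  vertices = allFin (ℕ.suc n)

  pushSum : V T → (V T → ℤ) → ℤ
  pushSum x C = ∑ vertices (neighbourPush x C)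

  -- the value left at x when T_x is reduced to x alone
  centreValue : V T → (V T → ℤ) → ℤ
  centreValue x Cx = Cx x ℤ.+ pushSum x Cx

  pushSum-change : ∀ {x y} (C C′ : V T → ℤ) → Adj T x y → (∀ w → w ≢ y → w ≢ x → C′ w ≡ C w) →
                   pushSum x C′ ℤ.+ push (C y) ≡ pushSum x C ℤ.+ push (C′ y)
  pushSum-change {x} {y} C C′ xy C′≡C = begin
    pushSum x C′ ℤ.+ push (C y)                   ≡⟨ cong (λ s → pushSum x C′ ℤ.+ s) (sym (neighbourPush-adj C xy)) ⟩
    pushSum x C′ ℤ.+ neighbourPush x C y
      ≡⟨ ∑-change-at _ _ vertices (Unique.allFin⁺ _) (Membership.∈-allFin y) agree ⟩
    pushSum x C ℤ.+ neighbourPush x C′ y          ≡⟨ cong (λ s → pushSum x C ℤ.+ s) (neighbourPush-adj C′ xy) ⟩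
    pushSum x C ℤ.+ push (C′ y)                   ∎
    where
    open ≡-Reasoning
    agree : ∀ w → w ≢ y → neighbourPush x C′ w ≡ neighbourPush x C w
    agree w w≢y = neighbourPush-cong w (C′≡C w w≢y)

  pushSum-negative : ∀ {x y₁ y₂} (C : V T → ℤ) → (∀ y → Adj T x y → C y < + 0) →
                     Adj T x y₁ → Adj T x y₂ → y₁ ≢ y₂ → pushSum x C ≤ℤ push (C y₁) ℤ.+ push (C y₂)
  pushSum-negative {x} {y₁} {y₂} C negative xy₁ xy₂ y₁≢y₂ = begin
    pushSum x C
      ≤⟨ ∑-≤-two vertices (Membership.∈-allFin y₁) (Membership.∈-allFin y₂) y₁≢y₂ nonpos ⟩
    neighbourPush x C y₁ ℤ.+ neighbourPush x C y₂
      ≡⟨ cong₂ ℤ._+_ (neighbourPush-adj C xy₁) (neighbourPush-adj C xy₂) ⟩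
    push (C y₁) ℤ.+ push (C y₂)                   ∎
    where
    open ℤP.≤-Reasoning
    nonpos : ∀ w → neighbourPush x C w ≤ℤ + 0
    nonpos w with adj? x w
    ... | yes xw = push-nonpos (negative w xw)
    ... | no _ = ℤP.≤-refl

  induced-reduces : ∀ {x C Cx} → Induced T x C Cx → ReducesTo (all-live , C) x (centreValue x Cx)
  induced-reduces {x} {C} {Cx} (S , chain , S≡Tx)
    with collapse x vertices (Unique.allFin⁺ _) S Cx inside complete (proj₂ (S≡Tx x) (inj₁ refl))
    where
    inside : ∀ w → S w ≡ true → w ≡ x ⊎ (Adj T x w × w ∈ vertices)
    inside w Sw with proj₁ (S≡Tx w) Sw
    ... | inj₁ w≡x = inj₁ w≡x
    ... | inj₂ xw = inj₂ (xw , Membership.∈-allFin w)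
    complete : ∀ w → Adj T x w → w ∈ vertices → S w ≡ true
    complete w xw _ = proj₂ (S≡Tx w) (inj₂ xw)
  ... | Sf , Cf , chain′ , single , value = Sf , Cf , Delete⇒Del chain ◅◅ chain′ , single , value

  boost : V T → V T → Dist T → Dist T
  boost x y D w = if ⌊ w F.≟ x ⌋ then 0 else (if ⌊ w F.≟ y ⌋ then D y ℕ.+ ℕ.suc (D x) else D w)

  boost-size : ∀ {x y} D → x ≢ y → size T (boost x y D) ≡ size T D ℕ.+ 1
  boost-size {x} {y} D x≢y = ℕP.+-cancelʳ-≡ (D y) _ _ (begin
    ΣB ℕ.+ D y                     ≡⟨ cong (ΣB ℕ.+_) (sym (if-≢ y≢x)) ⟩
    ΣB ℕ.+ E y                     ≡⟨ sum-change-at (boost x y D) E y boost≡E ⟩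
    ΣE ℕ.+ boost x y D y           ≡⟨ cong (ΣE ℕ.+_) (trans (if-≢ y≢x) (if-≡ {w = y} refl)) ⟩
    ΣE ℕ.+ (D y ℕ.+ ℕ.suc (D x))   ≡⟨ regroup ΣE (D x) (D y) ⟩
    (ΣE ℕ.+ D x) ℕ.+ 1 ℕ.+ D y     ≡⟨ cong (λ s → s ℕ.+ 1 ℕ.+ D y) emptied ⟩
    size T D ℕ.+ 1 ℕ.+ D y         ∎)
    where
    open ≡-Reasoning
    y≢x : y ≢ x
    y≢x y≡x = x≢y (sym y≡x)
    E : Dist T
    E w = if ⌊ w F.≟ x ⌋ then 0 else D w
    ΣB = size T (boost x y D)
    ΣE = size T E
    emptied : ΣE ℕ.+ D x ≡ size T D
    emptied = trans (sum-change-at E D x (λ w → if-≢)) (trans (cong (size T D ℕ.+_) (if-≡ {w = x} refl)) (ℕP.+-identityʳ _))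
    boost≡E : ∀ w → w ≢ y → boost x y D w ≡ E w
    boost≡E w w≢y with w F.≟ x
    ... | yes _ = refl
    ... | no _ = if-≢ w≢y
    regroup : ∀ s a b → s ℕ.+ (b ℕ.+ ℕ.suc a) ≡ (s ℕ.+ a) ℕ.+ 1 ℕ.+ b
    regroup = ℕSolver.solve-∀

  gain : V T → V T → Dist T → V T → ℤ
  gain x y D w = + boost x y D w ℤ.- + D w

  gain-x : ∀ {x y} D → gain x y D x ≡ ℤ.- + D x
  gain-x {x} D = trans (cong (λ b → + b ℤ.- + D x) (if-≡ {w = x} refl)) (ℤP.+-identityˡ _)

  gain-y : ∀ {x y} D → x ≢ y → gain x y D y ≡ + D x ℤ.+ + 1
  gain-y {x} {y} D x≢y = begin
    + boost x y D y ℤ.- + D y                   ≡⟨ cong (λ b → + b ℤ.- + D y) boosted ⟩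
    (+ D y ℤ.+ (+ 1 ℤ.+ + D x)) ℤ.- + D y       ≡⟨ cancel (+ D y) (+ D x) ⟩
    + D x ℤ.+ + 1                               ∎
    where
    open ≡-Reasoning
    boosted : boost x y D y ≡ D y ℕ.+ ℕ.suc (D x)
    boosted = trans (if-≢ (λ y≡x → x≢y (sym y≡x))) (if-≡ {w = y} refl)
    cancel : ∀ b a → (b ℤ.+ (+ 1 ℤ.+ a)) ℤ.- b ≡ a ℤ.+ + 1
    cancel = solve-∀

  gain-elsewhere : ∀ {x y w} D → w ≢ x → w ≢ y → gain x y D w ≡ + 0
  gain-elsewhere {w = w} D w≢x w≢y =
    trans (cong (λ b → + b ℤ.- + D w) (trans (if-≢ w≢x) (if-≢ w≢y))) (ℤP.+-inverseʳ (+ D w))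

  excess-boost : ∀ x y (ω D : V T → ℕ) w → excess T (boost x y D) ω w ≡ excess T D ω w ℤ.+ gain x y D w
  excess-boost x y ω D w = regroup (+ boost x y D w) (+ D w) (+ ω w)
    where
    regroup : ∀ b d o → b ℤ.- o ≡ (d ℤ.- o) ℤ.+ (b ℤ.- d)
    regroup = solve-∀

  -- The boosted distribution induces Cx shifted by the gain, since boosting
  -- only changes D at x and at its neighbour y.
  boost-induced : ∀ {ω D x y Cx} → Adj T x y → Induced T x (excess T D ω) Cx →
                  ∃[ Cx⁺ ] (Induced T x (excess T (boost x y D) ω) Cx⁺ × (∀ w → Cx⁺ w ≡ Cx w ℤ.+ gain x y D w))
  boost-induced {ω} {D} {x} {y} xy (S , chain , S≡Tx)
    with induced-shift chain (excess T (boost x y D) ω) (gain x y D) (excess-boost x y ω D) outside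
    where
    outside : ∀ w → ¬ InTx T x w → gain x y D w ≡ + 0
    outside w w∉Tx = gain-elsewhere D (λ w≡x → w∉Tx (inj₁ w≡x)) (λ { refl → w∉Tx (inj₂ xy) })
  ... | Cx⁺ , chain⁺ , Cx⁺≡ = Cx⁺ , (S , chain⁺ , S≡Tx) , Cx⁺≡

  -- Boosting
  -- D at y₁ gives γ pebbles, hence a solvable distribution; comparing the
  -- centre values of D (negative) and of its boost (nonnegative) is absurd.
  no-negative-star : ∀ {ω D γ x Cx y₁ y₂} → IsPebblingNumber T ω γ → ¬ Solvable T ω D →
                     size T D ℕ.+ 1 ≡ γ → Induced T x (excess T D ω) Cx →
                     (∀ y → Adj T x y → Cx y < + 0) →
                     Adj T x y₁ → Adj T x y₂ → y₁ ≢ y₂ → Cx y₂ ≤ℤ Cx y₁ → ⊥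
  no-negative-star {ω} {D} {γ} {x} {Cx} {y₁} {y₂} (all-solvable , _) unsolvable |D|+1≡γ
                   induced negative xy₁ xy₂ y₁≢y₂ Cy₂≤Cy₁
    with boost-induced {ω} {D} xy₁ induced | all-solvable (boost x y₁ D) (trans (boost-size D (adj-≢ xy₁)) |D|+1≡γ)
  ... | Cx⁺ , induced⁺ , Cx⁺≡ | _ , D⁺→D* , D*≥ω =
    boost-arith D-fails boost-succeeds sums-differ sum-bound (negative y₁ xy₁) centre-bound
    where
    D-fails : centreValue x Cx < + 0
    D-fails = ℤP.≰⇒> (λ 0≤ → unsolvable (reduction-sufficient ω D (induced-reduces induced) 0≤))
    boost-succeeds : + 0 ≤ℤ (Cx x ℤ.- + D x) ℤ.+ pushSum x Cx⁺
    boost-succeeds = subst (λ c → + 0 ≤ℤ c ℤ.+ pushSum x Cx⁺) Cx⁺-x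
                       (reduction-necessary ω D⁺→D* D*≥ω (induced-reduces induced⁺))
      where
      Cx⁺-x : Cx⁺ x ≡ Cx x ℤ.- + D x
      Cx⁺-x = trans (Cx⁺≡ x) (cong (λ g → Cx x ℤ.+ g) (gain-x {x} {y₁} D))
    sums-differ : pushSum x Cx⁺ ℤ.+ push (Cx y₁) ≡ pushSum x Cx ℤ.+ push (Cx y₁ ℤ.+ (+ D x ℤ.+ + 1))
    sums-differ = trans (pushSum-change Cx Cx⁺ xy₁ unchanged) (cong (λ c → pushSum x Cx ℤ.+ push c) Cx⁺-y₁)
      where
      Cx⁺-y₁ : Cx⁺ y₁ ≡ Cx y₁ ℤ.+ (+ D x ℤ.+ + 1)
      Cx⁺-y₁ = trans (Cx⁺≡ y₁) (cong (λ g → Cx y₁ ℤ.+ g) (gain-y D (adj-≢ xy₁)))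
      unchanged : ∀ w → w ≢ y₁ → w ≢ x → Cx⁺ w ≡ Cx w
      unchanged w w≢y₁ w≢x = trans (Cx⁺≡ w)
        (trans (cong (λ g → Cx w ℤ.+ g) (gain-elsewhere {x} {y₁} D w≢x w≢y₁)) (ℤP.+-identityʳ (Cx w)))
    sum-bound : pushSum x Cx ≤ℤ push (Cx y₁) ℤ.+ push (Cx y₁)
    sum-bound = ℤP.≤-trans (pushSum-negative Cx negative xy₁ xy₂ y₁≢y₂)
                  (ℤP.+-monoʳ-≤ (push (Cx y₁)) (push-mono Cy₂≤Cy₁))
    centre-bound : Cx x ≤ℤ + D x
    centre-bound = subst (_≤ℤ + D x) (sym (delete-fixes-centre (proj₁ (proj₂ induced))))
                     (ℤP.i-j≤i (+ D x) (+ ω x))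

lemma4 : (T : Tree) → 1 ≤ Tree.n T → (ω D : V T → ℕ) → (γ : ℕ) →
         IsPebblingNumber T ω γ → ¬ Solvable T ω D → size T D + 1 ≡ γ →
         (x : V T) → ¬ IsLeaf T x →
         (Cx : V T → ℤ) → Induced T x (excess T D ω) Cx →
         ∃[ y ] (Adj T x y × + 0 ≤ℤ Cx y)
lemma4 T 1≤n ω D γ γ-pebbling unsolvable |D|+1≡γ x not-leaf Cx induced
  with FP.any? (λ y → adj? T x y ×-dec (+ 0 ℤP.≤? Cx y))
... | yes nonnegative-neighbour = nonnegative-neighbour
... | no none = ⊥-elim (refute (two-neighbours T 1≤n x not-leaf))
  where
  negative : ∀ y → Adj T x y → Cx y < + 0
  negative y xy = ℤP.≰⇒> (λ 0≤Cy → none (y , xy , 0≤Cy))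
  -- of two neighbours, apply the core argument boosting the larger value
  refute : ∃[ y₁ ] ∃[ y₂ ] (Adj T x y₁ × Adj T x y₂ × y₁ ≢ y₂) → ⊥
  refute (y₁ , y₂ , xy₁ , xy₂ , y₁≢y₂) with ℤP.≤-total (Cx y₂) (Cx y₁)
  ... | inj₁ Cy₂≤Cy₁ =
    no-negative-star T γ-pebbling unsolvable |D|+1≡γ induced negative xy₁ xy₂ y₁≢y₂ Cy₂≤Cy₁
  ... | inj₂ Cy₁≤Cy₂ =
    no-negative-star T γ-pebbling unsolvable |D|+1≡γ induced negative xy₂ xy₁ (λ e → y₁≢y₂ (sym e)) Cy₁≤Cy₂
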